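{- Let $K$ be an algebraically closed field of characteristic zero and $E/K$ an elliptic curve given by a Weierstrass equation $y^2+a_1xy+a_3y=x^3+a_2x^2+a_4x+a_6$ with point at infinity $O$ and $b$-invariants $b_2,b_4,b_6$. Let $f(x)=x^3+\frac{b_2}{4}x^2+\frac{b_4}{2}x+\frac{b_6}{4}$. For $T\in E[2]$ define $M_T=E_2$ (the $2\times2$ identity matrix) if $T=O$ and \[ M_T=\begin{pmatrix} x(T) & f'(x(T))-x(T)^2\\ 1 & -x(T)\end{pmatrix}\quad\text{if } T\neq O. \] Let $\varepsilon(O)=1$ and $\varepsilon(T)=-1$ for $T\in E[2]\setminus\{O\}$, and let $e_2:E[2]\times E[2]\to\mu_2$ be the Weil pairing, which satisfies $e_2(T,T')=\varepsilon(T)\varepsilon(T')\varepsilon(T+T')$. Then for all $T,T'\in E[2]$, \[ M_{T'}M_T=\begin{cases}\varepsilon(T)\det(M_T)\,E_2, & T=T',\\ e_2(T,T')\,M_TM_{T'}, & T\neq T'.\end{cases} \] -}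

module Defs where

open import Level using (Level; suc; _⊔_; Lift)
open import Data.Nat using (ℕ; zero) renaming (suc to sucℕ)
open import Data.List using (List; []; _∷_)
open import Data.Product using (_×_; Σ; ∃; _,_)
open import Data.Sum using (_⊎_)
open import Data.Unit.Polymorphic using (⊤)
open import Data.Empty.Polymorphic using (⊥)
open import Relation.Nullary using (¬_)
open import Algebra.Bundles using (CommutativeRing)

record Field c ℓ : Set (suc (c ⊔ ℓ)) where
  field
    commutativeRing : CommutativeRing c ℓ
  open CommutativeRing commutativeRing public
  field
    _⁻¹        : Carrier → Carrier
    ⁻¹-inverse : ∀ x → ¬ (x ≈ 0#) → (x * (x ⁻¹)) ≈ 1#
    0≉1        : ¬ (0# ≈ 1#)

module FieldDefs {c ℓ} (K : Field c ℓ) where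
  open Field K

  fromℕ : ℕ → Carrier
  fromℕ zero     = 0#
  fromℕ (sucℕ n) = 1# + fromℕ n

  CharZero : Set ℓ
  CharZero = ∀ n → ¬ (fromℕ (sucℕ n) ≈ 0#)

  -- value of the monic polynomial c₀ + c₁x + … + c_{k-1}x^{k-1} + x^k
  -- whose lower coefficients are the list [c₀, …, c_{k-1}]
  evalMonic : List Carrier → Carrier → Carrier
  evalMonic []       x = 1#
  evalMonic (a ∷ as) x = a + x * evalMonic as x

  AlgClosed : Set (c ⊔ ℓ)
  AlgClosed = ∀ (a : Carrier) (as : List Carrier) → ∃ λ x → evalMonic (a ∷ as) x ≈ 0#

  record Mat2 : Set c where
    constructor mat
    field
      m11 m12 m21 m22 : Carrier

  infixl 7 _·M_
  _·M_ : Mat2 → Mat2 → Mat2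
  mat a b c' d ·M mat e f g h =
    mat (a * e + b * g) (a * f + b * h) (c' * e + d * g) (c' * f + d * h)

  _•M_ : Carrier → Mat2 → Mat2
  s •M mat a b c' d = mat (s * a) (s * b) (s * c') (s * d)

  infix 4 _≈M_
  _≈M_ : Mat2 → Mat2 → Set ℓ
  mat a b c' d ≈M mat e f g h = (a ≈ e) × (b ≈ f) × (c' ≈ g) × (d ≈ h)

  det : Mat2 → Carrier
  det (mat a b c' d) = a * d - b * c'

  E₂ : Mat2
  E₂ = mat 1# 0# 0# 1#

  record WCoeffs : Set c where
    field
      a₁ a₂ a₃ a₄ a₆ : Carrier

  module Invariants (w : WCoeffs) where
    open WCoeffs w
    b₂ b₄ b₆ b₈ Δ : Carrier
    b₂ = a₁ * a₁ + fromℕ 4 * a₂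
    b₄ = fromℕ 2 * a₄ + a₁ * a₃
    b₆ = a₃ * a₃ + fromℕ 4 * a₆
    b₈ = a₁ * a₁ * a₆ + fromℕ 4 * a₂ * a₆ - a₁ * a₃ * a₄ + a₂ * a₃ * a₃ - a₄ * a₄
    Δ = (- (b₂ * b₂ * b₈)) - fromℕ 8 * b₄ * b₄ * b₄ - fromℕ 27 * b₆ * b₆
          + fromℕ 9 * b₂ * b₄ * b₆

  record Weierstrass : Set (c ⊔ ℓ) where
    field
      coeffs : WCoeffs
      Δ≉0    : ¬ (Invariants.Δ coeffs ≈ 0#)
    open WCoeffs coeffs public
    open Invariants coeffs public

  data Point : Set c where
    O  : Point
    pt : Carrier → Carrier → Point

  PtEq : Point → Point → Set ℓ
  PtEq O O = ⊤
  PtEq O (pt _ _) = ⊥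
  PtEq (pt _ _) O = ⊥
  PtEq (pt x y) (pt x' y') = (x ≈ x') × (y ≈ y')

  module Curve (E : Weierstrass) where
    open Weierstrass E

    OnCurve : Point → Set ℓ
    OnCurve O = ⊤
    OnCurve (pt x y) = y * y + a₁ * x * y + a₃ * y ≈ x * x * x + a₂ * x * x + a₄ * x + a₆

    -- the third intersection point reflected: result of the chord/tangent
    -- construction with slope λ through (x₁,y₁) and (x₂,·)
    chord : Carrier → Carrier → Carrier → Carrier → Point
    chord λ' x₁ y₁ x₂ = pt x₃ (- ((λ' + a₁) * x₃) - ν - a₃)
      where
      x₃ = λ' * λ' + a₁ * λ' - a₂ - x₁ - x₂
      ν  = y₁ - λ' * x₁

    -- IsSum P Q R : R = P + Q in the group law of E (chord–tangent law)
    IsSum : Point → Point → Point → Set (c ⊔ ℓ)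
    IsSum O Q R = Lift c (PtEq R Q)
    IsSum (pt x y) O R = Lift c (PtEq R (pt x y))
    IsSum (pt x₁ y₁) (pt x₂ y₂) R =
      Lift c ((x₁ ≈ x₂) × (y₁ + y₂ + a₁ * x₂ + a₃ ≈ 0#) × PtEq R O)
      ⊎ (Σ Carrier λ λ' →
           ( ((¬ (x₁ ≈ x₂)) × (λ' * (x₂ - x₁) ≈ y₂ - y₁))
           ⊎ ((x₁ ≈ x₂) × (¬ (y₁ + y₂ + a₁ * x₂ + a₃ ≈ 0#))
              × (λ' * (fromℕ 2 * y₁ + a₁ * x₁ + a₃)
                   ≈ fromℕ 3 * x₁ * x₁ + fromℕ 2 * a₂ * x₁ + a₄ - a₁ * y₁)))
           × PtEq R (chord λ' x₁ y₁ x₂))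

    InE2 : Point → Set (c ⊔ ℓ)
    InE2 T = OnCurve T × IsSum T T O

    f : Carrier → Carrier
    f x = x * x * x + b₂ * (fromℕ 4 ⁻¹) * x * x + b₄ * (fromℕ 2 ⁻¹) * x + b₆ * (fromℕ 4 ⁻¹)

    f′ : Carrier → Carrier
    f′ x = fromℕ 3 * x * x + fromℕ 2 * (b₂ * (fromℕ 4 ⁻¹)) * x + b₄ * (fromℕ 2 ⁻¹)

    M : Point → Mat2
    M O = E₂
    M (pt x y) = mat x (f′ x - x * x) 1# (- x)

    ε : Point → Carrier
    ε O = 1#
    ε (pt _ _) = - 1#

    -- Weil pairing on E[2], via e₂(T,T') = ε(T)ε(T')ε(T+T'), where R = T + T'
    e₂ : Point → Point → Point → Carrier
    e₂ T T' R = ε T * ε T' * ε R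

module Submission where

-- A 2-torsion point T = (x, y) ≠ O has a vertical tangent, ψ₂ = 2y + a₁x + a₃ = 0, and on
-- the curve ψ₂² = 4x³ + b₂x² + 2b₄x + b₆ = 4 f(x); so x is a root of f, and x determines y.
-- M_T is traceless, hence M_T² = -det(M_T) E₂ by Cayley–Hamilton: this is the case T = T'.
-- For distinct T, T' ≠ O the x-coordinates are distinct roots of f, so the divided
-- difference f[x, x'] vanishes, and M_T, M_T' anticommute, as e₂(T, T') = (-1)³ predicts.
-- M_O = E₂ commutes with everything, matching e₂(O, T) = 1.

open import Defs
open import Data.Nat as ℕ using (zero; suc)
import Data.Nat.Properties as ℕ
open import Data.Integer as ℤ using (ℤ; +_; -[1+_]; _⊖_; _◃_)
import Data.Integer.Properties as ℤ
open import Data.Sign as Sign using (Sign)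
open import Data.Product using (_×_; _,_)
open import Data.Sum using (inj₁; inj₂)
open import Data.Empty using (⊥-elim)
open import Data.Unit.Polymorphic using (tt)
open import Data.Maybe using (Maybe; map)
open import Level using (lift)
open import Relation.Nullary using (¬_)
import Relation.Binary.PropositionalEquality as ≡
open import Relation.Binary.Consequences using (dec⇒weaklyDec)
open import Algebra.Bundles using (CommutativeRing)
open import Algebra.Solver.Ring.AlmostCommutativeRing
  using (_-Raw-AlmostCommutative⟶_; fromCommutativeRing)
import Algebra.Solver.Ring
import Algebra.Properties.Ring
import Algebra.Properties.Semiring.Mult
import Relation.Binary.Reasoning.Setoid as SetoidReasoning

module IntegerCoefficientSolver {c ℓ} (R : CommutativeRing c ℓ) where
  open CommutativeRing R
  open Algebra.Properties.Ring ring
    using (-0#≈0#; -‿involutive; -‿distribˡ-*; -‿distribʳ-*; -‿+-comm)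
  open Algebra.Properties.Semiring.Mult semiring using (×-homo-+; ×1-homo-*)
    renaming (_×_ to _·_)
  open SetoidReasoning setoid

  signed : Sign → Carrier → Carrier
  signed Sign.+ x = x
  signed Sign.- x = - x

  signed-cong : ∀ s {x y} → x ≈ y → signed s x ≈ signed s y
  signed-cong Sign.+ x≈y = x≈y
  signed-cong Sign.- x≈y = -‿cong x≈y

  signed-* : ∀ s t x y → signed (s Sign.* t) (x * y) ≈ signed s x * signed t y
  signed-* Sign.+ Sign.+ x y = refl
  signed-* Sign.+ Sign.- x y = -‿distribʳ-* x y
  signed-* Sign.- Sign.+ x y = -‿distribˡ-* x y
  signed-* Sign.- Sign.- x y = begin
    x * y        ≈⟨ -‿involutive _ ⟨
    - - (x * y)  ≈⟨ -‿cong (-‿distribˡ-* x y) ⟩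
    - (- x * y)  ≈⟨ -‿distribʳ-* (- x) y ⟩
    - x * - y    ∎

  fromℤ : ℤ → Carrier
  fromℤ i = signed (ℤ.sign i) (ℤ.∣ i ∣ · 1#)

  fromℤ-◃ : ∀ s n → fromℤ (s ◃ n) ≈ signed s (n · 1#)
  fromℤ-◃ Sign.+ zero    = refl
  fromℤ-◃ Sign.- zero    = sym -0#≈0#
  fromℤ-◃ Sign.+ (suc n) = refl
  fromℤ-◃ Sign.- (suc n) = refl

  [1+x]-[1+y]≈x-y : ∀ x y → (1# + x) - (1# + y) ≈ x - y
  [1+x]-[1+y]≈x-y x y = begin
    (1# + x) - (1# + y)      ≈⟨ +-cong (+-comm 1# x) (sym (-‿+-comm 1# y)) ⟩
    (x + 1#) + (- 1# + - y)  ≈⟨ +-assoc x 1# _ ⟩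
    x + (1# + (- 1# + - y))  ≈⟨ +-congˡ (sym (+-assoc 1# _ _)) ⟩
    x + ((1# - 1#) + - y)    ≈⟨ +-congˡ (+-congʳ (-‿inverseʳ 1#)) ⟩
    x + (0# + - y)           ≈⟨ +-congˡ (+-identityˡ (- y)) ⟩
    x - y                    ∎

  fromℤ-⊖ : ∀ m n → fromℤ (m ⊖ n) ≈ m · 1# - n · 1#
  fromℤ-⊖ m       zero    = sym (trans (+-congˡ -0#≈0#) (+-identityʳ (m · 1#)))
  fromℤ-⊖ zero    (suc n) = sym (+-identityˡ _)
  fromℤ-⊖ (suc m) (suc n) = begin
    fromℤ (suc m ⊖ suc n)    ≡⟨ ≡.cong fromℤ (ℤ.[1+m]⊖[1+n]≡m⊖n m n) ⟩
    fromℤ (m ⊖ n)            ≈⟨ fromℤ-⊖ m n ⟩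
    m · 1# - n · 1#          ≈⟨ [1+x]-[1+y]≈x-y _ _ ⟨
    suc m · 1# - suc n · 1#  ∎

  fromℤ-+ : ∀ i j → fromℤ (i ℤ.+ j) ≈ fromℤ i + fromℤ j
  fromℤ-+ (+ m)    (+ n)    = ×-homo-+ 1# m n
  fromℤ-+ (+ m)    -[1+ n ] = fromℤ-⊖ m (suc n)
  fromℤ-+ -[1+ m ] (+ n)    = trans (fromℤ-⊖ n (suc m)) (+-comm _ _)
  fromℤ-+ -[1+ m ] -[1+ n ] = begin
    - (suc (suc (m ℕ.+ n)) · 1#)     ≡⟨ ≡.cong (λ k → - (suc k · 1#)) (ℕ.+-suc m n) ⟨
    - ((suc m ℕ.+ suc n) · 1#)       ≈⟨ -‿cong (×-homo-+ 1# (suc m) (suc n)) ⟩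
    - (suc m · 1# + suc n · 1#)      ≈⟨ -‿+-comm _ _ ⟨
    - (suc m · 1#) + - (suc n · 1#)  ∎

  fromℤ-* : ∀ i j → fromℤ (i ℤ.* j) ≈ fromℤ i * fromℤ j
  fromℤ-* i j = begin
    fromℤ (i ℤ.* j)                          ≈⟨ fromℤ-◃ s (ℤ.∣ i ∣ ℕ.* ℤ.∣ j ∣) ⟩
    signed s ((ℤ.∣ i ∣ ℕ.* ℤ.∣ j ∣) · 1#)     ≈⟨ signed-cong s (×1-homo-* ℤ.∣ i ∣ ℤ.∣ j ∣) ⟩
    signed s ((ℤ.∣ i ∣ · 1#) * (ℤ.∣ j ∣ · 1#)) ≈⟨ signed-* (ℤ.sign i) (ℤ.sign j) _ _ ⟩
    fromℤ i * fromℤ j                        ∎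
    where s = ℤ.sign i Sign.* ℤ.sign j

  fromℤ-neg : ∀ i → fromℤ (ℤ.- i) ≈ - fromℤ i
  fromℤ-neg (+ zero)  = sym -0#≈0#
  fromℤ-neg (+ suc n) = refl
  fromℤ-neg -[1+ n ]  = sym (-‿involutive _)

  -- Agrees with fromℤ, but sends 1 to 1# itself instead of 1# + 0#, so that
  -- solver constants are definitionally the literals 1# and FieldDefs.fromℕ n.
  ⟦_⟧ℤ : ℤ → Carrier
  ⟦ + 1 ⟧ℤ = 1#
  ⟦ i   ⟧ℤ = fromℤ i

  ⟦⟧ℤ≈fromℤ : ∀ i → ⟦ i ⟧ℤ ≈ fromℤ i
  ⟦⟧ℤ≈fromℤ (+ zero)          = refl
  ⟦⟧ℤ≈fromℤ (+ suc zero)      = sym (+-identityʳ 1#)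
  ⟦⟧ℤ≈fromℤ (+ suc (suc n))   = refl
  ⟦⟧ℤ≈fromℤ -[1+ n ]          = refl

  ⟦⟧ℤ-homomorphism : ℤ.+-*-rawRing -Raw-AlmostCommutative⟶ fromCommutativeRing R
  ⟦⟧ℤ-homomorphism = record
    { ⟦_⟧    = ⟦_⟧ℤ
    ; +-homo = λ i j → transport (i ℤ.+ j) (fromℤ-+ i j) (+-cong (⟦⟧ℤ≈fromℤ i) (⟦⟧ℤ≈fromℤ j))
    ; *-homo = λ i j → transport (i ℤ.* j) (fromℤ-* i j) (*-cong (⟦⟧ℤ≈fromℤ i) (⟦⟧ℤ≈fromℤ j))
    ; -‿homo = λ i → transport (ℤ.- i) (fromℤ-neg i) (-‿cong (⟦⟧ℤ≈fromℤ i))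
    ; 0-homo = refl
    ; 1-homo = refl
    }
    where
    transport : ∀ i {x y} → fromℤ i ≈ y → x ≈ y → ⟦ i ⟧ℤ ≈ x
    transport i p q = trans (⟦⟧ℤ≈fromℤ i) (trans p (sym q))

  ⟦⟧ℤ-weaklyDecidable : ∀ i j → Maybe (⟦ i ⟧ℤ ≈ ⟦ j ⟧ℤ)
  ⟦⟧ℤ-weaklyDecidable i j = map (λ i≡j → reflexive (≡.cong ⟦_⟧ℤ i≡j)) (dec⇒weaklyDec ℤ._≟_ i j)

  open Algebra.Solver.Ring ℤ.+-*-rawRing (fromCommutativeRing R) ⟦⟧ℤ-homomorphism
    ⟦⟧ℤ-weaklyDecidable
    public

module FieldProperties {c ℓ} (K : Field c ℓ) where
  open Field K
  open SetoidReasoning setoid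

  x≉0⇒x*y≈0⇒y≈0 : ∀ {x y} → ¬ x ≈ 0# → x * y ≈ 0# → y ≈ 0#
  x≉0⇒x*y≈0⇒y≈0 {x} {y} x≉0 xy≈0 = begin
    y                 ≈⟨ *-identityˡ y ⟨
    1# * y            ≈⟨ *-congʳ (trans (*-comm _ _) (⁻¹-inverse x x≉0)) ⟨
    (x ⁻¹ * x) * y    ≈⟨ *-assoc _ _ _ ⟩
    x ⁻¹ * (x * y)    ≈⟨ *-congˡ xy≈0 ⟩
    x ⁻¹ * 0#         ≈⟨ zeroʳ _ ⟩
    0#                ∎

  x+k*z≈x : ∀ x k {z} → z ≈ 0# → x + k * z ≈ x
  x+k*z≈x x k z≈0 = trans (+-congˡ (trans (*-congˡ z≈0) (zeroʳ k))) (+-identityʳ x)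

module Matrices {c ℓ} (K : Field c ℓ) where
  open Field K
  open FieldDefs K
  open IntegerCoefficientSolver commutativeRing using (solve; _:=_; _:+_; _:*_; :-_; _:-_; con)

  ≈M-sym : ∀ {A B} → A ≈M B → B ≈M A
  ≈M-sym {mat _ _ _ _} {mat _ _ _ _} (p , q , r , s) = sym p , sym q , sym r , sym s

  ≈M-trans : ∀ {A B C} → A ≈M B → B ≈M C → A ≈M C
  ≈M-trans {mat _ _ _ _} {mat _ _ _ _} {mat _ _ _ _} (p , q , r , s) (p′ , q′ , r′ , s′) =
    trans p p′ , trans q q′ , trans r r′ , trans s s′

  ·M-congʳ : ∀ {A A′} B → A ≈M A′ → A ·M B ≈M A′ ·M B
  ·M-congʳ {mat _ _ _ _} {mat _ _ _ _} (mat _ _ _ _) (p , q , r , s) =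
      +-cong (*-congʳ p) (*-congʳ q) , +-cong (*-congʳ p) (*-congʳ q)
    , +-cong (*-congʳ r) (*-congʳ s) , +-cong (*-congʳ r) (*-congʳ s)

  •M-congʳ : ∀ {s t} A → s ≈ t → s •M A ≈M t •M A
  •M-congʳ (mat _ _ _ _) s≈t = *-congʳ s≈t , *-congʳ s≈t , *-congʳ s≈t , *-congʳ s≈t

  •M-identity : ∀ {s} A → s ≈ 1# → s •M A ≈M A
  •M-identity {s} (mat a b c′ d) s≈1 = unit a , unit b , unit c′ , unit d
    where
    unit : ∀ x → s * x ≈ x
    unit x = trans (*-congʳ s≈1) (*-identityˡ x)

  ·M-identityˡ : ∀ A → E₂ ·M A ≈M A
  ·M-identityˡ (mat a b c′ d) = 1x+0y≈x a c′ , 1x+0y≈x b d , 0x+1y≈y a c′ , 0x+1y≈y b d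
    where
    1x+0y≈x : ∀ x y → 1# * x + 0# * y ≈ x
    0x+1y≈y : ∀ x y → 0# * x + 1# * y ≈ y
    1x+0y≈x = solve 2 (λ x y → con (+ 1) :* x :+ con (+ 0) :* y := x) refl
    0x+1y≈y = solve 2 (λ x y → con (+ 0) :* x :+ con (+ 1) :* y := y) refl

  ·M-identityʳ : ∀ A → A ·M E₂ ≈M A
  ·M-identityʳ (mat a b c′ d) = x1+y0≈x a b , x0+y1≈y a b , x1+y0≈x c′ d , x0+y1≈y c′ d
    where
    x1+y0≈x : ∀ x y → x * 1# + y * 0# ≈ x
    x0+y1≈y : ∀ x y → x * 0# + y * 1# ≈ y
    x1+y0≈x = solve 2 (λ x y → x :* con (+ 1) :+ y :* con (+ 0) := x) refl
    x0+y1≈y = solve 2 (λ x y → x :* con (+ 0) :+ y :* con (+ 1) := y) refl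

  ·M-E₂-comm : ∀ A → A ·M E₂ ≈M E₂ ·M A
  ·M-E₂-comm A = ≈M-trans (·M-identityʳ A) (≈M-sym (·M-identityˡ A))

  traceless-square : ∀ a b c′ → let A = mat a b c′ (- a) in A ·M A ≈M (- det A) •M E₂
  traceless-square a b c′ =
      solve 3 (λ a b c → a :* a :+ b :* c := :- (a :* :- a :- b :* c) :* con (+ 1)) refl a b c′
    , solve 3 (λ a b c → a :* b :+ b :* :- a := :- (a :* :- a :- b :* c) :* con (+ 0)) refl a b c′
    , solve 3 (λ a b c → c :* a :+ :- a :* c := :- (a :* :- a :- b :* c) :* con (+ 0)) refl a b c′
    , solve 3 (λ a b c → c :* b :+ :- a :* :- a := :- (a :* :- a :- b :* c) :* con (+ 1)) refl a b c′

module TwoTorsion {c ℓ} (K : Field c ℓ) (char0 : FieldDefs.CharZero K)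
                  (E : FieldDefs.Weierstrass K) where
  open Field K
  open FieldDefs K
  open Weierstrass E
  open Curve E
  open FieldProperties K
  open Matrices K
  open IntegerCoefficientSolver commutativeRing
    using (Polynomial; solve; _:=_; _:+_; _:*_; :-_; _:-_; con)
  open Algebra.Properties.Ring ring using (-1*x≈-x)
    renaming (x∙y⁻¹≈ε⇒x≈y to x-y≈0⇒x≈y; x≈y⇒x∙y⁻¹≈ε to x≈y⇒x-y≈0)
  open SetoidReasoning setoid

  ψ₂ : Carrier → Carrier → Carrier
  ψ₂ x y = y + y + a₁ * x + a₃

  ψ₂² : Carrier → Carrier
  ψ₂² x = fromℕ 4 * x * x * x + b₂ * x * x + fromℕ 2 * b₄ * x + b₆

  ψ₂-squared : ∀ {x y} → OnCurve (pt x y) → ψ₂ x y * ψ₂ x y ≈ ψ₂² x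
  ψ₂-squared {x} {y} on-curve = begin
    ψ₂ x y * ψ₂ x y                                     ≈⟨ identity ⟩
    ψ₂² x + fromℕ 4 * (lhs - rhs)                       ≈⟨ x+k*z≈x _ (fromℕ 4) (x≈y⇒x-y≈0 on-curve) ⟩
    ψ₂² x                                               ∎
    where
    lhs rhs : Carrier
    lhs = y * y + a₁ * x * y + a₃ * y
    rhs = x * x * x + a₂ * x * x + a₄ * x + a₆
    identity : ψ₂ x y * ψ₂ x y ≈ ψ₂² x + fromℕ 4 * (lhs - rhs)
    identity = solve 7 (λ x y a₁ a₂ a₃ a₄ a₆ →
      let b₂ = a₁ :* a₁ :+ con (+ 4) :* a₂
          b₄ = con (+ 2) :* a₄ :+ a₁ :* a₃
          b₆ = a₃ :* a₃ :+ con (+ 4) :* a₆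
          ψ  = y :+ y :+ a₁ :* x :+ a₃
      in ψ :* ψ
         := (con (+ 4) :* x :* x :* x :+ b₂ :* x :* x :+ con (+ 2) :* b₄ :* x :+ b₆)
            :+ con (+ 4) :* ((y :* y :+ a₁ :* x :* y :+ a₃ :* y)
                             :- (x :* x :* x :+ a₂ :* x :* x :+ a₄ :* x :+ a₆)))
      refl x y a₁ a₂ a₃ a₄ a₆

  4f≈ψ₂² : ∀ x → fromℕ 4 * f x ≈ ψ₂² x
  4f≈ψ₂² x = begin
    fromℕ 4 * f x
      ≈⟨ identity ⟩
    ψ₂² x + (b₂ * x * x + b₆) * (fromℕ 4 * q - 1#) + fromℕ 2 * b₄ * x * (fromℕ 2 * h - 1#)
      ≈⟨ x+k*z≈x _ _ (x≈y⇒x-y≈0 (⁻¹-inverse (fromℕ 2) (char0 1))) ⟩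
    ψ₂² x + (b₂ * x * x + b₆) * (fromℕ 4 * q - 1#)
      ≈⟨ x+k*z≈x _ _ (x≈y⇒x-y≈0 (⁻¹-inverse (fromℕ 4) (char0 3))) ⟩
    ψ₂² x
      ∎
    where
    q h : Carrier
    q = fromℕ 4 ⁻¹
    h = fromℕ 2 ⁻¹
    identity : fromℕ 4 * f x
               ≈ ψ₂² x + (b₂ * x * x + b₆) * (fromℕ 4 * q - 1#) + fromℕ 2 * b₄ * x * (fromℕ 2 * h - 1#)
    identity = solve 6 (λ x b₂ b₄ b₆ q h →
      con (+ 4) :* (x :* x :* x :+ b₂ :* q :* x :* x :+ b₄ :* h :* x :+ b₆ :* q)
      := (con (+ 4) :* x :* x :* x :+ b₂ :* x :* x :+ con (+ 2) :* b₄ :* x :+ b₆)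
         :+ (b₂ :* x :* x :+ b₆) :* (con (+ 4) :* q :- con (+ 1))
         :+ con (+ 2) :* b₄ :* x :* (con (+ 2) :* h :- con (+ 1)))
      refl x b₂ b₄ b₆ q h

  E[2]⇒ψ₂≈0 : ∀ {x y} → InE2 (pt x y) → ψ₂ x y ≈ 0#
  E[2]⇒ψ₂≈0 (_ , inj₁ (lift (_ , ψ₂≈0 , _))) = ψ₂≈0
  E[2]⇒ψ₂≈0 (_ , inj₂ (_ , _ , ()))

  E[2]⇒f≈0 : ∀ {x y} → InE2 (pt x y) → f x ≈ 0#
  E[2]⇒f≈0 {x} {y} T∈E[2]@(on-curve , _) = x≉0⇒x*y≈0⇒y≈0 (char0 3) (begin
    fromℕ 4 * f x     ≈⟨ 4f≈ψ₂² x ⟩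
    ψ₂² x             ≈⟨ ψ₂-squared on-curve ⟨
    ψ₂ x y * ψ₂ x y   ≈⟨ *-congʳ (E[2]⇒ψ₂≈0 T∈E[2]) ⟩
    0# * ψ₂ x y       ≈⟨ zeroˡ _ ⟩
    0#                ∎)

  ψ₂-injectiveʸ : ∀ {x x′ y y′} → x ≈ x′ → ψ₂ x y ≈ ψ₂ x′ y′ → y ≈ y′
  ψ₂-injectiveʸ {x} {x′} {y} {y′} x≈x′ ψ₂≈ψ₂′ = x-y≈0⇒x≈y y y′ (x≉0⇒x*y≈0⇒y≈0 (char0 1) (begin
    fromℕ 2 * (y - y′)                                  ≈⟨ identity ⟩
    (ψ₂ x y - ψ₂ x′ y′) + a₁ * (x′ - x)                 ≈⟨ x+k*z≈x _ a₁ (x≈y⇒x-y≈0 (sym x≈x′)) ⟩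
    ψ₂ x y - ψ₂ x′ y′                                   ≈⟨ x≈y⇒x-y≈0 ψ₂≈ψ₂′ ⟩
    0#                                                  ∎))
    where
    identity : fromℕ 2 * (y - y′) ≈ (ψ₂ x y - ψ₂ x′ y′) + a₁ * (x′ - x)
    identity = solve 6 (λ x x′ y y′ a₁ a₃ →
      con (+ 2) :* (y :- y′)
      := ((y :+ y :+ a₁ :* x :+ a₃) :- (y′ :+ y′ :+ a₁ :* x′ :+ a₃)) :+ a₁ :* (x′ :- x))
      refl x x′ y y′ a₁ a₃

  E[2]-x-injective : ∀ {x x′ y y′} → InE2 (pt x y) → InE2 (pt x′ y′) → x ≈ x′ →
                     PtEq (pt x y) (pt x′ y′)
  E[2]-x-injective T∈E[2] T′∈E[2] x≈x′ =
    x≈x′ , ψ₂-injectiveʸ x≈x′ (trans (E[2]⇒ψ₂≈0 T∈E[2]) (sym (E[2]⇒ψ₂≈0 T′∈E[2])))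

  f[_,_] : Carrier → Carrier → Carrier
  f[ x , x′ ] = x * x + x * x′ + x′ * x′ + b₂ * fromℕ 4 ⁻¹ * (x + x′) + b₄ * fromℕ 2 ⁻¹

  f-difference : ∀ x x′ → f x - f x′ ≈ (x - x′) * f[ x , x′ ]
  f-difference x x′ = solve 7 (λ x x′ b₂ b₄ b₆ q h →
    (x :* x :* x :+ b₂ :* q :* x :* x :+ b₄ :* h :* x :+ b₆ :* q)
    :- (x′ :* x′ :* x′ :+ b₂ :* q :* x′ :* x′ :+ b₄ :* h :* x′ :+ b₆ :* q)
    := (x :- x′) :* (x :* x :+ x :* x′ :+ x′ :* x′ :+ b₂ :* q :* (x :+ x′) :+ b₄ :* h)) refl
    x x′ b₂ b₄ b₆ (fromℕ 4 ⁻¹) (fromℕ 2 ⁻¹)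

  f[x,x′]≈0 : ∀ {x x′} → f x ≈ f x′ → ¬ x ≈ x′ → f[ x , x′ ] ≈ 0#
  f[x,x′]≈0 {x} {x′} fx≈fx′ x≉x′ = x≉0⇒x*y≈0⇒y≈0 (λ d≈0 → x≉x′ (x-y≈0⇒x≈y x x′ d≈0))
    (trans (sym (f-difference x x′)) (x≈y⇒x-y≈0 fx≈fx′))

  -- M (pt x′ _) ·M M (pt x _) + M (pt x _) ·M M (pt x′ _) is 2 f[ x , x′ ] E₂.
  M-anticommute : ∀ {x x′} y y′ → f[ x , x′ ] ≈ 0# →
                  M (pt x′ y′) ·M M (pt x y) ≈M (- 1#) •M (M (pt x y) ·M M (pt x′ y′))
  M-anticommute {x} {x′} _ _ f[x,x′]≈0 =
      trans entry₁₁ (x+k*z≈x _ (fromℕ 2) f[x,x′]≈0)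
    , entry₁₂
    , entry₂₁
    , trans entry₂₂ (x+k*z≈x _ (fromℕ 2) f[x,x′]≈0)
    where
    g : Carrier → Carrier
    g x = f′ x - x * x

    G : ∀ {n} → (b₂ b₄ q h x : Polynomial n) → Polynomial n
    G b₂ b₄ q h x = con (+ 3) :* x :* x :+ con (+ 2) :* (b₂ :* q) :* x :+ b₄ :* h :- x :* x

    entry₁₁ : x′ * x + g x′ * 1# ≈ - 1# * (x * x′ + g x * 1#) + fromℕ 2 * f[ x , x′ ]
    entry₁₁ = solve 6 (λ x x′ b₂ b₄ q h → let g = G b₂ b₄ q h in
      x′ :* x :+ g x′ :* con (+ 1)
      := :- con (+ 1) :* (x :* x′ :+ g x :* con (+ 1))
         :+ con (+ 2) :* (x :* x :+ x :* x′ :+ x′ :* x′ :+ b₂ :* q :* (x :+ x′) :+ b₄ :* h))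
      refl x x′ b₂ b₄ (fromℕ 4 ⁻¹) (fromℕ 2 ⁻¹)

    entry₁₂ : x′ * g x + g x′ * - x ≈ - 1# * (x * g x′ + g x * - x′)
    entry₁₂ = solve 6 (λ x x′ b₂ b₄ q h → let g = G b₂ b₄ q h in
      x′ :* g x :+ g x′ :* :- x := :- con (+ 1) :* (x :* g x′ :+ g x :* :- x′))
      refl x x′ b₂ b₄ (fromℕ 4 ⁻¹) (fromℕ 2 ⁻¹)

    entry₂₁ : 1# * x + - x′ * 1# ≈ - 1# * (1# * x′ + - x * 1#)
    entry₂₁ = solve 2 (λ x x′ →
      con (+ 1) :* x :+ :- x′ :* con (+ 1) := :- con (+ 1) :* (con (+ 1) :* x′ :+ :- x :* con (+ 1)))
      refl x x′

    entry₂₂ : 1# * g x + - x′ * - x ≈ - 1# * (1# * g x′ + - x * - x′) + fromℕ 2 * f[ x , x′ ]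
    entry₂₂ = solve 6 (λ x x′ b₂ b₄ q h → let g = G b₂ b₄ q h in
      con (+ 1) :* g x :+ :- x′ :* :- x
      := :- con (+ 1) :* (con (+ 1) :* g x′ :+ :- x :* :- x′)
         :+ con (+ 2) :* (x :* x :+ x :* x′ :+ x′ :* x′ :+ b₂ :* q :* (x :+ x′) :+ b₄ :* h))
      refl x x′ b₂ b₄ (fromℕ 4 ⁻¹) (fromℕ 2 ⁻¹)

  M-cong : ∀ {x x′} y y′ → x ≈ x′ → M (pt x y) ≈M M (pt x′ y′)
  M-cong {x} {x′} _ _ x≈x′ = x≈x′ , +-cong f′-cong (-‿cong (*-cong x≈x′ x≈x′)) , refl , -‿cong x≈x′
    where
    f′-cong : f′ x ≈ f′ x′
    f′-cong = +-cong (+-cong (*-cong (*-congˡ x≈x′) x≈x′) (*-congˡ x≈x′)) refl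

  M-square : ∀ T T′ → PtEq T T′ → M T′ ·M M T ≈M (ε T * det (M T)) •M E₂
  M-square O O _ = ≈M-trans (·M-identityˡ E₂) (≈M-sym (•M-identity E₂ 1*det[E₂]≈1))
    where
    1*det[E₂]≈1 : 1# * det E₂ ≈ 1#
    1*det[E₂]≈1 = solve 0
      (con (+ 1) :* (con (+ 1) :* con (+ 1) :- con (+ 0) :* con (+ 0)) := con (+ 1)) refl
  M-square (pt x y) (pt x′ y′) (x≈x′ , _) =
    ≈M-trans (·M-congʳ (M (pt x y)) (M-cong y′ y (sym x≈x′)))
      (≈M-trans (traceless-square x (f′ x - x * x) 1#) (•M-congʳ E₂ (sym (-1*x≈-x _))))

  M-anticommutation : ∀ {T T′} → InE2 T → InE2 T′ → ¬ PtEq T T′ →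
                      ∀ R → IsSum T T′ R → M T′ ·M M T ≈M e₂ T T′ R •M (M T ·M M T′)
  M-anticommutation {O} {O} _ _ O≉O = ⊥-elim (O≉O tt)
  M-anticommutation {O} {pt x′ y′} _ _ _ (pt _ _) _ =
    ≈M-trans (·M-E₂-comm _) (≈M-sym (•M-identity _ 1*-1*-1≈1))
    where
    1*-1*-1≈1 : 1# * - 1# * - 1# ≈ 1#
    1*-1*-1≈1 = solve 0 (con (+ 1) :* :- con (+ 1) :* :- con (+ 1) := con (+ 1)) refl
  M-anticommutation {pt x y} {O} _ _ _ (pt _ _) _ =
    ≈M-trans (≈M-sym (·M-E₂-comm _)) (≈M-sym (•M-identity _ -1*1*-1≈1))
    where
    -1*1*-1≈1 : - 1# * 1# * - 1# ≈ 1#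
    -1*1*-1≈1 = solve 0 (:- con (+ 1) :* con (+ 1) :* :- con (+ 1) := con (+ 1)) refl
  M-anticommutation {pt x y} {pt x′ y′} T∈E[2] T′∈E[2] T≉T′ _ (inj₁ (lift (x≈x′ , _))) =
    ⊥-elim (T≉T′ (E[2]-x-injective T∈E[2] T′∈E[2] x≈x′))
  M-anticommutation {pt x y} {pt x′ y′} T∈E[2] T′∈E[2] T≉T′ _ (inj₂ (_ , inj₂ (x≈x′ , _) , _)) =
    ⊥-elim (T≉T′ (E[2]-x-injective T∈E[2] T′∈E[2] x≈x′))
  M-anticommutation {pt x y} {pt x′ y′} T∈E[2] T′∈E[2] _ (pt _ _) (inj₂ (_ , inj₁ (x≉x′ , _) , _)) =
    ≈M-trans (M-anticommute y y′ (f[x,x′]≈0 fx≈fx′ x≉x′)) (•M-congʳ _ (sym -1*-1*-1≈-1))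
    where
    fx≈fx′ : f x ≈ f x′
    fx≈fx′ = trans (E[2]⇒f≈0 T∈E[2]) (sym (E[2]⇒f≈0 T′∈E[2]))
    -1*-1*-1≈-1 : - 1# * - 1# * - 1# ≈ - 1#
    -1*-1*-1≈-1 = solve 0 (:- con (+ 1) :* :- con (+ 1) :* :- con (+ 1) := :- con (+ 1)) refl

lemma2p2 : ∀ {c ℓ} (K : Field c ℓ) → FieldDefs.AlgClosed K → FieldDefs.CharZero K → (E : FieldDefs.Weierstrass K) → (T T' : FieldDefs.Point K) → FieldDefs.Curve.InE2 K E T → FieldDefs.Curve.InE2 K E T' →
    let open Field K
        open FieldDefs K
        open Curve E
    in (PtEq T T' → M T' ·M M T ≈M (ε T * det (M T)) •M E₂)
    × (¬ PtEq T T' → ∀ R → IsSum T T' R → M T' ·M M T ≈M e₂ T T' R •M (M T ·M M T'))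
lemma2p2 K _ char0 E T T' T∈E[2] T'∈E[2] =
  M-square T T' , M-anticommutation T∈E[2] T'∈E[2]
  where open TwoTorsion K char0 E
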